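{- Let $k\in\mathbb N$, $l\in\mathbb N$, $i,r_1,\dots,r_l\in E_k$ and $c_1,\dots,c_l\in\{0,1\}$. Then \[\Big\langle (x^i=0)\lor(y^i=1)\lor\bigvee_{h=1}^l(z_h^{r_h}=c_h)\Big\rangle_{\mathrm{qpp}}=\Big\langle (x^i=0)\lor(y^i=1)\lor\bigvee_{h=2}^l(z_h^{r_h}=c_h),\ (x^i=0)\lor(y^i=1)\lor(z_1^{r_1}=c_1)\Big\rangle_{\mathrm{qpp}}.\]
   Context: $E_k=\{1,\dots,k\}$; superscripts denote sorts. A $k$-sorted relation on $\{0,1\}$ is a subset of $\{0,1\}^n$ with each variable assigned a sort in $E_k$; a displayed disjunction of equations denotes the relation on its variables (with indicated sorts) it defines. $\sigma_\bot$ is the empty $0$-ary relation, $\sigma^i_=$ equality on sort $i$. For a set $S$ of relations, $\langle S\rangle_{\mathrm{qpp}}$ is the set of relations definable by formulas built from predicates in $S\cup\{\sigma_\bot,\sigma_=^1,\dots,\sigma_=^k\}$ using conjunction, existential and universal quantification only, each variable having one sort and substituted only into positions of that sort. -}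

module Defs where

open import Data.Nat using (ℕ; zero; suc)
open import Data.Fin using (Fin; zero; suc)
open import Data.Bool using (Bool; true; false; _∧_; _∨_; not; _xor_)
open import Data.Product using (Σ; _×_; _,_)
open import Data.Sum using (_⊎_)
open import Relation.Binary.PropositionalEquality using (_≡_)
open import Data.Vec.Functional using (_∷_)

-- A k-sorted relation on {0,1}: arity n, a sort (element of E_k ≅ Fin k)
-- for each coordinate, and the set of tuples as a characteristic function
-- (false = 0, true = 1).
record SRel (k : ℕ) : Set where
  constructor srel
  field
    arity : ℕ
    sort  : Fin arity → Fin k
    rel   : (Fin arity → Bool) → Bool
open SRel public

RelSet : ℕ → Set₁
RelSet k = SRel k → Set

-- qpp-formulas over S, in a context of m variables with sorts γ
-- (de Bruijn: the newest bound variable is index zero).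
data Formula {k : ℕ} (S : RelSet k) : (m : ℕ) → (Fin m → Fin k) → Set where
  atom : ∀ {m γ} (R : SRel k) → S R →
         (v : Fin (arity R) → Fin m) → (∀ j → γ (v j) ≡ sort R j) →
         Formula S m γ
  bot  : ∀ {m γ} → Formula S m γ
  eq   : ∀ {m γ} (x y : Fin m) → γ x ≡ γ y → Formula S m γ
  conj : ∀ {m γ} → Formula S m γ → Formula S m γ → Formula S m γ
  ex   : ∀ {m γ} (s : Fin k) → Formula S (suc m) (s ∷ γ) → Formula S m γ
  all  : ∀ {m γ} (s : Fin k) → Formula S (suc m) (s ∷ γ) → Formula S m γ

_==ᵇ_ : Bool → Bool → Bool
a ==ᵇ b = not (a xor b)

⟦_⟧ : ∀ {k} {S : RelSet k} {m γ} → Formula S m γ → (Fin m → Bool) → Bool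
⟦ atom R _ v _ ⟧ ρ = rel R (λ j → ρ (v j))
⟦ bot ⟧ ρ = false
⟦ eq x y _ ⟧ ρ = ρ x ==ᵇ ρ y
⟦ conj φ ψ ⟧ ρ = ⟦ φ ⟧ ρ ∧ ⟦ ψ ⟧ ρ
⟦ ex s φ ⟧ ρ = ⟦ φ ⟧ (false ∷ ρ) ∨ ⟦ φ ⟧ (true ∷ ρ)
⟦ all s φ ⟧ ρ = ⟦ φ ⟧ (false ∷ ρ) ∧ ⟦ φ ⟧ (true ∷ ρ)

_∈qpp_ : ∀ {k} → SRel k → RelSet k → Set
R ∈qpp S = Σ (Formula S (arity R) (sort R)) λ φ → ∀ t → ⟦ φ ⟧ t ≡ rel R t

_≐qpp_ : ∀ {k} → RelSet k → RelSet k → Set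
S₁ ≐qpp S₂ = ∀ R → (R ∈qpp S₁ → R ∈qpp S₂) × (R ∈qpp S₂ → R ∈qpp S₁)

anyFin : ∀ {l} → (Fin l → Bool) → Bool
anyFin {zero} f = false
anyFin {suc l} f = f zero ∨ anyFin (λ h → f (suc h))

-- (x^i = 0) ∨ (y^i = 1) ∨ ⋁_{h} (z_h^{r h} = c h), variables ordered x, y, z_1, …, z_l
clause : ∀ {k l} (i : Fin k) (r : Fin l → Fin k) (c : Fin l → Bool) → SRel k
clause {k} {l} i r c = srel (suc (suc l)) srt R
  where
  srt : Fin (suc (suc l)) → Fin k
  srt zero = i
  srt (suc zero) = i
  srt (suc (suc h)) = r h
  R : (Fin (suc (suc l)) → Bool) → Bool
  R t = not (t zero) ∨ t (suc zero) ∨ anyFin (λ h → t (suc (suc h)) ==ᵇ c h)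

single : ∀ {k} → SRel k → RelSet k
single A R = R ≡ A

pair : ∀ {k} → SRel k → SRel k → RelSet k
pair A B R = R ≡ A ⊎ R ≡ B

{-# OPTIONS --safe #-}
module Submission where

-- Write C for the clause, B for its part with the single z-disjunct z₁ = c₁ and A for the part
-- with the remaining ones. C is the resolvent of B and A on a fresh variable u of sort i,
--   C(x, y, z₁, z⃗) ⇔ ∃u. B(x, u, z₁) ∧ A(u, y, z⃗),
-- since u = 0 satisfies A and leaves ¬x ∨ (z₁ = c₁) for B, while u = 1 satisfies B and leaves
-- y ∨ ⋁ (z⃗ = c⃗) for A. Conversely, universally quantifying the variable of a z-disjunct removes
-- that disjunct, as z = c fails for one of the two values of z; this gives A from C in one step
-- and B from C by removing z₂, …, z_l one at a time.

open import Defs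
open import Data.Nat using (ℕ; zero; suc; _+_)
open import Data.Fin using (Fin; zero; suc; lift; punchIn)
open import Data.Bool using (Bool; true; false; _∧_; _∨_; not)
open import Data.Bool.Properties using (∨-assoc; ∨-comm)
open import Data.Product using (_,_; proj₁; proj₂)
open import Data.Sum using (inj₁; inj₂)
open import Data.Vec.Functional using (Vector; []; _∷_; tail; map; insertAt; removeAt)
open import Data.Vec.Functional.Properties using (insertAt-lookup; insertAt-punchIn; insertAt-removeAt)
open import Function using (_∘_; id)
open import Function.Definitions using (Congruent)
open import Relation.Binary.PropositionalEquality
  using (_≡_; _≗_; refl; sym; trans; cong; cong₂; module ≡-Reasoning)

open ≡-Reasoning

-- Relations are Bool-valued functions on tuples, and without function extensionality they
-- need not respect pointwise equality of tuples, which is all that renaming variables yields.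
Extensional : ∀ {k} → RelSet k → Set
Extensional S = ∀ {R} → S R → Congruent _≗_ _≡_ (rel R)

single-extensional : ∀ {k} {A : SRel k} → Congruent _≗_ _≡_ (rel A) → Extensional (single A)
single-extensional A-cong refl = A-cong

pair-extensional : ∀ {k} {A B : SRel k} →
                   Congruent _≗_ _≡_ (rel A) → Congruent _≗_ _≡_ (rel B) → Extensional (pair A B)
pair-extensional A-cong B-cong (inj₁ refl) = A-cong
pair-extensional A-cong B-cong (inj₂ refl) = B-cong

∷-∘-lift : ∀ {A : Set} {m n} (f : Fin m → Fin n) (g : Vector A n) (h : Vector A m) (a : A) →
           g ∘ f ≗ h → (a ∷ g) ∘ lift 1 f ≗ a ∷ h
∷-∘-lift f g h a g∘f≗h zero    = refl
∷-∘-lift f g h a g∘f≗h (suc j) = g∘f≗h j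

module _ {k} {S : RelSet k} where

  rename : ∀ {m n} {γ : Fin m → Fin k} {δ : Fin n → Fin k} (f : Fin m → Fin n) →
           δ ∘ f ≗ γ → Formula S m γ → Formula S n δ
  rename f δ∘f≗γ (atom R R∈S v sorts) = atom R R∈S (f ∘ v) (λ j → trans (δ∘f≗γ (v j)) (sorts j))
  rename f δ∘f≗γ bot                  = bot
  rename f δ∘f≗γ (eq x y γx≡γy)       = eq (f x) (f y) (trans (δ∘f≗γ x) (trans γx≡γy (sym (δ∘f≗γ y))))
  rename f δ∘f≗γ (conj φ ψ)           = conj (rename f δ∘f≗γ φ) (rename f δ∘f≗γ ψ)
  rename {γ = γ} {δ} f δ∘f≗γ (ex s φ)  = ex s (rename (lift 1 f) (∷-∘-lift f δ γ s δ∘f≗γ) φ)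
  rename {γ = γ} {δ} f δ∘f≗γ (all s φ) = all s (rename (lift 1 f) (∷-∘-lift f δ γ s δ∘f≗γ) φ)

  ⟦rename⟧ : Extensional S → ∀ {m n} {γ : Fin m → Fin k} {δ : Fin n → Fin k}
             (f : Fin m → Fin n) (δ∘f≗γ : δ ∘ f ≗ γ) (φ : Formula S m γ) (ρ : Vector Bool m) (σ : Vector Bool n) →
             σ ∘ f ≗ ρ → ⟦ rename f δ∘f≗γ φ ⟧ σ ≡ ⟦ φ ⟧ ρ
  ⟦rename⟧ S-ext f δ∘f≗γ (atom R R∈S v sorts) ρ σ σ∘f≗ρ = S-ext R∈S (σ∘f≗ρ ∘ v)
  ⟦rename⟧ S-ext f δ∘f≗γ bot                  ρ σ σ∘f≗ρ = refl
  ⟦rename⟧ S-ext f δ∘f≗γ (eq x y γx≡γy)       ρ σ σ∘f≗ρ = cong₂ _==ᵇ_ (σ∘f≗ρ x) (σ∘f≗ρ y)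
  ⟦rename⟧ S-ext f δ∘f≗γ (conj φ ψ)           ρ σ σ∘f≗ρ =
    cong₂ _∧_ (⟦rename⟧ S-ext f δ∘f≗γ φ ρ σ σ∘f≗ρ) (⟦rename⟧ S-ext f δ∘f≗γ ψ ρ σ σ∘f≗ρ)
  ⟦rename⟧ S-ext {γ = γ} {δ} f δ∘f≗γ (ex s φ) ρ σ σ∘f≗ρ =
    cong₂ _∨_ (under false) (under true)
    where
    under : ∀ b → ⟦ rename (lift 1 f) (∷-∘-lift f δ γ s δ∘f≗γ) φ ⟧ (b ∷ σ) ≡ ⟦ φ ⟧ (b ∷ ρ)
    under b = ⟦rename⟧ S-ext (lift 1 f) _ φ (b ∷ ρ) (b ∷ σ) (∷-∘-lift f σ ρ b σ∘f≗ρ)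
  ⟦rename⟧ S-ext {γ = γ} {δ} f δ∘f≗γ (all s φ) ρ σ σ∘f≗ρ =
    cong₂ _∧_ (under false) (under true)
    where
    under : ∀ b → ⟦ rename (lift 1 f) (∷-∘-lift f δ γ s δ∘f≗γ) φ ⟧ (b ∷ σ) ≡ ⟦ φ ⟧ (b ∷ ρ)
    under b = ⟦rename⟧ S-ext (lift 1 f) _ φ (b ∷ ρ) (b ∷ σ) (∷-∘-lift f σ ρ b σ∘f≗ρ)

module _ {k} {S T : RelSet k} (T-ext : Extensional T) (S⊆⟨T⟩ : ∀ {R} → S R → R ∈qpp T) where

  unfoldAtoms : ∀ {m γ} → Formula S m γ → Formula T m γ
  unfoldAtoms (atom R R∈S v sorts) = rename v sorts (proj₁ (S⊆⟨T⟩ R∈S))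
  unfoldAtoms bot                  = bot
  unfoldAtoms (eq x y γx≡γy)       = eq x y γx≡γy
  unfoldAtoms (conj φ ψ)           = conj (unfoldAtoms φ) (unfoldAtoms ψ)
  unfoldAtoms (ex s φ)             = ex s (unfoldAtoms φ)
  unfoldAtoms (all s φ)            = all s (unfoldAtoms φ)

  ⟦unfoldAtoms⟧ : ∀ {m γ} (φ : Formula S m γ) ρ → ⟦ unfoldAtoms φ ⟧ ρ ≡ ⟦ φ ⟧ ρ
  ⟦unfoldAtoms⟧ (atom R R∈S v sorts) ρ =
    trans (⟦rename⟧ T-ext v sorts (proj₁ (S⊆⟨T⟩ R∈S)) (ρ ∘ v) ρ (λ _ → refl)) (proj₂ (S⊆⟨T⟩ R∈S) (ρ ∘ v))
  ⟦unfoldAtoms⟧ bot            ρ = refl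
  ⟦unfoldAtoms⟧ (eq x y γx≡γy) ρ = refl
  ⟦unfoldAtoms⟧ (conj φ ψ)     ρ = cong₂ _∧_ (⟦unfoldAtoms⟧ φ ρ) (⟦unfoldAtoms⟧ ψ ρ)
  ⟦unfoldAtoms⟧ (ex s φ)       ρ = cong₂ _∨_ (⟦unfoldAtoms⟧ φ (false ∷ ρ)) (⟦unfoldAtoms⟧ φ (true ∷ ρ))
  ⟦unfoldAtoms⟧ (all s φ)      ρ = cong₂ _∧_ (⟦unfoldAtoms⟧ φ (false ∷ ρ)) (⟦unfoldAtoms⟧ φ (true ∷ ρ))

  ∈qpp-trans : ∀ {R} → R ∈qpp S → R ∈qpp T
  ∈qpp-trans (φ , ⟦φ⟧≡R) = unfoldAtoms φ , λ t → trans (⟦unfoldAtoms⟧ φ t) (⟦φ⟧≡R t)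

map-insertAt : ∀ {A B : Set} {n} (f : A → B) (xs : Vector A n) (p : Fin (suc n)) (a : A) →
               map f (insertAt xs p a) ≗ insertAt (map f xs) p (f a)
map-insertAt f xs zero a zero    = refl
map-insertAt f xs zero a (suc j) = refl
map-insertAt {n = suc n} f xs (suc p) a zero    = refl
map-insertAt {n = suc n} f xs (suc p) a (suc j) = map-insertAt f (tail xs) p a j

anyFin-cong : ∀ {l} {f g : Vector Bool l} → f ≗ g → anyFin f ≡ anyFin g
anyFin-cong {zero}  f≗g = refl
anyFin-cong {suc l} f≗g = cong₂ _∨_ (f≗g zero) (anyFin-cong (f≗g ∘ suc))

anyFin-removeAt : ∀ {l} (f : Vector Bool (suc l)) (p : Fin (suc l)) → anyFin f ≡ anyFin (removeAt f p) ∨ f p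
anyFin-removeAt f zero = ∨-comm (f zero) (anyFin (tail f))
anyFin-removeAt {suc l} f (suc p) = begin
  f zero ∨ anyFin (tail f)                              ≡⟨ cong (f zero ∨_) (anyFin-removeAt (tail f) p) ⟩
  f zero ∨ (anyFin (removeAt (tail f) p) ∨ f (suc p))   ≡⟨ ∨-assoc (f zero) _ (f (suc p)) ⟨
  anyFin (removeAt f (suc p)) ∨ f (suc p)               ∎

clause-congruent : ∀ {k l} (i : Fin k) (r : Fin l → Fin k) (c : Fin l → Bool) → Congruent _≗_ _≡_ (rel (clause i r c))
clause-congruent i r c t≗u =
  cong₂ _∨_ (cong not (t≗u zero)) (cong₂ _∨_ (t≗u (suc zero)) (anyFin-cong (λ h → cong (_==ᵇ c h) (t≗u (suc (suc h))))))

clause-insertAt : ∀ {k l} (i : Fin k) (r : Fin (suc l) → Fin k) (c : Fin (suc l) → Bool) (p : Fin (suc l))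
                  (x y : Bool) (zs : Vector Bool l) (b : Bool) →
                  rel (clause i r c) (x ∷ y ∷ insertAt zs p b)
                    ≡ rel (clause i (removeAt r p) (removeAt c p)) (x ∷ y ∷ zs) ∨ (b ==ᵇ c p)
clause-insertAt {l = l} i r c p x y zs b = begin
  not x ∨ (y ∨ anyFin z≟c)                                      ≡⟨ cong (λ q → not x ∨ (y ∨ q)) (anyFin-removeAt z≟c p) ⟩
  not x ∨ (y ∨ (anyFin (removeAt z≟c p) ∨ z≟c p))               ≡⟨ cong (λ q → not x ∨ (y ∨ q)) (cong₂ _∨_ removed inserted) ⟩
  not x ∨ (y ∨ (anyFin z≟c′ ∨ (b ==ᵇ c p)))                      ≡⟨ cong (not x ∨_) (∨-assoc y _ _) ⟨
  not x ∨ ((y ∨ anyFin z≟c′) ∨ (b ==ᵇ c p))                      ≡⟨ ∨-assoc (not x) _ _ ⟨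
  (not x ∨ (y ∨ anyFin z≟c′)) ∨ (b ==ᵇ c p)                      ∎
  where
  z≟c : Vector Bool (suc l)
  z≟c h = insertAt zs p b h ==ᵇ c h
  z≟c′ : Vector Bool l
  z≟c′ h = zs h ==ᵇ removeAt c p h
  removed : anyFin (removeAt z≟c p) ≡ anyFin z≟c′
  removed = anyFin-cong (λ h → cong (_==ᵇ c (punchIn p h)) (insertAt-punchIn zs p b h))
  inserted : z≟c p ≡ (b ==ᵇ c p)
  inserted = cong (_==ᵇ c p) (insertAt-lookup zs p b)

∀-literal-elim : ∀ q c → (q ∨ (false ==ᵇ c)) ∧ (q ∨ (true ==ᵇ c)) ≡ q
∀-literal-elim true  c     = refl
∀-literal-elim false false = refl
∀-literal-elim false true  = refl

clause-removeAt-∈qpp : ∀ {k l} (i : Fin k) (r : Fin (suc l) → Fin k) (c : Fin (suc l) → Bool) (p : Fin (suc l)) →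
                       clause i (removeAt r p) (removeAt c p) ∈qpp single (clause i r c)
clause-removeAt-∈qpp {k} {l} i r c p = all (r p) (atom C refl v sorts) , ⟦∀z⟧
  where
  C D : SRel k
  C = clause i r c
  D = clause i (removeAt r p) (removeAt c p)
  z⃗ : Vector (Fin (3 + l)) l
  z⃗ h = suc (suc (suc h))
  v : Vector (Fin (3 + l)) (3 + l)
  v = suc zero ∷ suc (suc zero) ∷ insertAt z⃗ p zero
  sorts : ∀ j → (r p ∷ sort D) (v j) ≡ sort C j
  sorts zero          = refl
  sorts (suc zero)    = refl
  sorts (suc (suc h)) = trans (map-insertAt (r p ∷ sort D) z⃗ p zero h) (insertAt-removeAt r p h)
  instantiate : ∀ ρ b → rel C ((b ∷ ρ) ∘ v) ≡ rel D ρ ∨ (b ==ᵇ c p)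
  instantiate ρ b = trans (clause-congruent i r c env) (clause-insertAt i r c p (ρ zero) (ρ (suc zero)) (tail (tail ρ)) b)
    where
    env : (b ∷ ρ) ∘ v ≗ ρ zero ∷ ρ (suc zero) ∷ insertAt (tail (tail ρ)) p b
    env zero          = refl
    env (suc zero)    = refl
    env (suc (suc h)) = map-insertAt (b ∷ ρ) z⃗ p zero h
  ⟦∀z⟧ : ∀ ρ → rel C ((false ∷ ρ) ∘ v) ∧ rel C ((true ∷ ρ) ∘ v) ≡ rel D ρ
  ⟦∀z⟧ ρ = trans (cong₂ _∧_ (instantiate ρ false) (instantiate ρ true)) (∀-literal-elim (rel D ρ) (c p))

clause-head-∈qpp : ∀ {k l} (i : Fin k) (r : Fin (suc l) → Fin k) (c : Fin (suc l) → Bool) →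
                   clause i (λ (_ : Fin 1) → r zero) (λ _ → c zero) ∈qpp single (clause i r c)
clause-head-∈qpp {l = zero} i r c = atom (clause i r c) refl id sorts , λ _ → refl
  where
  sorts : ∀ j → sort (clause i (λ (_ : Fin 1) → r zero) (λ _ → c zero)) j ≡ sort (clause i r c) j
  sorts zero             = refl
  sorts (suc zero)       = refl
  sorts (suc (suc zero)) = refl
clause-head-∈qpp {l = suc l} i r c =
  ∈qpp-trans (single-extensional (clause-congruent i r c)) (λ { refl → clause-removeAt-∈qpp i r c (suc zero) })
             (clause-head-∈qpp i (removeAt r (suc zero)) (removeAt c (suc zero)))

∃-resolution : ∀ x y p q →
               let B u = not x ∨ (u ∨ (p ∨ false))
                   A u = not u ∨ (y ∨ q)
               in (B false ∧ A false) ∨ (B true ∧ A true) ≡ not x ∨ (y ∨ (p ∨ q))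
∃-resolution false y     p     q = refl
∃-resolution true  y     false q = refl
∃-resolution true  false true  q = refl
∃-resolution true  true  true  q = refl

clause-∈qpp-resolvent : ∀ {k l} (i : Fin k) (r : Fin (suc l) → Fin k) (c : Fin (suc l) → Bool) →
                        clause i r c ∈qpp pair (clause i (λ h → r (suc h)) (λ h → c (suc h)))
                                               (clause i (λ (_ : Fin 1) → r zero) (λ _ → c zero))
clause-∈qpp-resolvent {l = l} i r c =
  ex i (conj (atom _ (inj₂ refl) xuz₁ sortsB) (atom _ (inj₁ refl) uyz⃗ sortsA)) ,
  λ t → ∃-resolution (t zero) (t (suc zero)) (t (suc (suc zero)) ==ᵇ c zero)
                     (anyFin (λ h → t (suc (suc (suc h))) ==ᵇ c (suc h)))
  where
  xuz₁ : Vector (Fin (4 + l)) 3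
  xuz₁ = suc zero ∷ zero ∷ suc (suc (suc zero)) ∷ []
  uyz⃗ : Vector (Fin (4 + l)) (2 + l)
  uyz⃗ = zero ∷ suc (suc zero) ∷ λ h → suc (suc (suc (suc h)))
  sortsB : ∀ j → (i ∷ sort (clause i r c)) (xuz₁ j) ≡ sort (clause i (λ (_ : Fin 1) → r zero) (λ _ → c zero)) j
  sortsB zero             = refl
  sortsB (suc zero)       = refl
  sortsB (suc (suc zero)) = refl
  sortsA : ∀ j → (i ∷ sort (clause i r c)) (uyz⃗ j) ≡ sort (clause i (λ h → r (suc h)) (λ h → c (suc h))) j
  sortsA zero          = refl
  sortsA (suc zero)    = refl
  sortsA (suc (suc h)) = refl

lemma3p9 : (k l : ℕ) (i : Fin k) (r : Fin (suc l) → Fin k) (c : Fin (suc l) → Bool) →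
    single (clause i r c)
      ≐qpp pair (clause i (λ h → r (suc h)) (λ h → c (suc h)))
                (clause i (λ (_ : Fin 1) → r zero) (λ _ → c zero))
lemma3p9 _ _ i r c _ =
    ∈qpp-trans (pair-extensional (clause-congruent i (λ h → r (suc h)) (λ h → c (suc h)))
                                 (clause-congruent i (λ (_ : Fin 1) → r zero) (λ _ → c zero)))
               (λ { refl → clause-∈qpp-resolvent i r c })
  , ∈qpp-trans (single-extensional (clause-congruent i r c))
               (λ { (inj₁ refl) → clause-removeAt-∈qpp i r c zero ; (inj₂ refl) → clause-head-∈qpp i r c })
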